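{- Let $r\ge1$, let $a,b,a_1,\dots,a_r$ be positive integers and $H_1,\dots,H_r$ graphs with $\max\{a_1,\dots,a_r\}\le a$ and $\max\{cl(H_1),\dots,cl(H_r)\}\le b$. Then $$F_v(K_{a_1}[H_1],\dots,K_{a_r}[H_r];ab+1)\le F_v(a_1,\dots,a_r;a+1)\,F_v(H_1,\dots,H_r;b+1).$$
   Context: $cl(H)$ denotes the clique number of $H$. For graphs $G,H_1,\dots,H_r$, $G \rightarrow (H_1,\dots,H_r)^v$ means: for every partition $V(G)=X_1\cup\dots\cup X_r$ there is $i$ such that the subgraph induced by $X_i$ contains a copy of $H_i$. An integer $a_i$ in place of a graph stands for $K_{a_i}$. The generalized vertex Folkman number $F_v(H_1,\dots,H_r;k)$ is the smallest number of vertices of a $K_k$-free graph $G$ with $G\rightarrow (H_1,\dots,H_r)^v$. The lexicographic product $K_a[H]$ (and generally $G[H]$) has vertex set $V(G)\times V(H)$, with $\{(u_1,v_1),(u_2,v_2)\}$ an edge iff $\{u_1,u_2\}\in E(G)$, or $u_1=u_2$ and $\{v_1,v_2\}\in E(H)$. -}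

module Defs where

open import Data.Nat using (ℕ; zero; suc; _+_; _*_; _≤_; _<_)
open import Data.Bool using (Bool; true; false; _∨_; _∧_; not)
open import Data.Bool.Properties using (∧-zeroʳ)
open import Data.Fin using (Fin; remQuot; _≟_)
open import Data.Product using (Σ; ∃; _×_; _,_; proj₁; proj₂)
open import Relation.Nullary using (¬_; yes; no; Dec)
open import Relation.Nullary.Decidable using (⌊_⌋)
open import Relation.Binary.PropositionalEquality using (_≡_; refl; sym)
open import Function.Definitions using (Injective)

record Graph : Set where
  field
    size  : ℕ
    adj   : Fin size → Fin size → Bool
    adj-sym   : ∀ u v → adj u v ≡ adj v u
    adj-irrefl : ∀ u → adj u u ≡ false
open Graph public

Edge : (G : Graph) → Fin (size G) → Fin (size G) → Set
Edge G u v = adj G u v ≡ true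

private
  eqb : ∀ {n} → Fin n → Fin n → Bool
  eqb u v = ⌊ u ≟ v ⌋

  eqb-sym : ∀ {n} (u v : Fin n) → eqb u v ≡ eqb v u
  eqb-sym u v with u ≟ v | v ≟ u
  ... | yes _ | yes _ = refl
  ... | yes p | no ¬q = Data.Empty.⊥-elim (¬q (sym p))
    where import Data.Empty
  ... | no ¬p | yes q = Data.Empty.⊥-elim (¬p (sym q))
    where import Data.Empty
  ... | no _ | no _ = refl

  eqb-refl : ∀ {n} (u : Fin n) → eqb u u ≡ true
  eqb-refl u with u ≟ u
  ... | yes _ = refl
  ... | no ¬p = Data.Empty.⊥-elim (¬p refl)
    where import Data.Empty

K : ℕ → Graph
K k = record
  { size = k
  ; adj = λ u v → not (eqb u v)
  ; adj-sym = λ u v → cong′ (eqb-sym u v)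
  ; adj-irrefl = λ u → cong′ (eqb-refl u)
  }
  where
  cong′ : ∀ {x y : Bool} → x ≡ y → not x ≡ not y
  cong′ refl = refl

-- Lexicographic product G[H] on vertex set Fin (|G| * |H|), identified with
-- Fin |G| × Fin |H| via remQuot: (u1,v1) ~ (u2,v2) iff u1u2 ∈ E(G), or
-- u1 = u2 and v1v2 ∈ E(H).
lexAdjP : (G H : Graph) → Fin (size G) × Fin (size H) → Fin (size G) × Fin (size H) → Bool
lexAdjP G H (u1 , v1) (u2 , v2) = adj G u1 u2 ∨ (eqb u1 u2 ∧ adj H v1 v2)

private
  lexAdjP-sym : (G H : Graph) → ∀ x y → lexAdjP G H x y ≡ lexAdjP G H y x
  lexAdjP-sym G H (u1 , v1) (u2 , v2)
    rewrite adj-sym G u1 u2 | adj-sym H v1 v2 | eqb-sym u1 u2 = refl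

  lexAdjP-irrefl : (G H : Graph) → ∀ x → lexAdjP G H x x ≡ false
  lexAdjP-irrefl G H (u , v)
    rewrite adj-irrefl G u | adj-irrefl H v | ∧-zeroʳ (eqb u u) = refl

Lex : Graph → Graph → Graph
Lex G H = record
  { size = size G * size H
  ; adj = λ x y → lexAdjP G H (remQuot (size H) x) (remQuot (size H) y)
  ; adj-sym = λ x y → lexAdjP-sym G H (remQuot (size H) x) (remQuot (size H) y)
  ; adj-irrefl = λ x → lexAdjP-irrefl G H (remQuot (size H) x)
  }

-- A copy of H in G whose vertices all lie in X (a (not necessarily induced)
-- subgraph of G[X] isomorphic to H): an injective edge-preserving map.
CopyIn : (H G : Graph) → (Fin (size G) → Set) → Set
CopyIn H G X =
  Σ (Fin (size H) → Fin (size G)) λ f →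
    Injective _≡_ _≡_ f × (∀ v → X (f v)) × (∀ u v → Edge H u v → Edge G (f u) (f v))

Contains : Graph → Graph → Set
Contains G H = CopyIn H G (λ _ → Data.Unit.⊤)
  where import Data.Unit

Free : ℕ → Graph → Set
Free k G = ¬ Contains G (K k)

CliqueNumber≤ : Graph → ℕ → Set
CliqueNumber≤ H b = ∀ k → Contains H (K k) → k ≤ b

-- G → (H_1,…,H_r)^v : for every partition V(G) = X_1 ∪ … ∪ X_r (given as a
-- colouring c : V(G) → Fin r, X_i = c⁻¹(i)) some G[X_i] contains a copy of H_i.
Arrows : (G : Graph) (r : ℕ) → (Fin r → Graph) → Set
Arrows G r Hs = (c : Fin (size G) → Fin r) → ∃ λ i → CopyIn (Hs i) G (λ x → c x ≡ i)

Admissible : (r : ℕ) → (Fin r → Graph) → ℕ → Graph → Set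
Admissible r Hs k G = Free k G × Arrows G r Hs

IsFolkmanNumber : (r : ℕ) → (Fin r → Graph) → ℕ → ℕ → Set
IsFolkmanNumber r Hs k N =
  (Σ Graph λ G → size G ≡ N × Admissible r Hs k G) ×
  (∀ G → Admissible r Hs k G → N ≤ size G)

-- Take graphs G and H realising the two Folkman numbers on the right; their
-- lexicographic product G[H] has |G|·|H| vertices and is admissible on the left.
-- It is K_{ab+1}-free: a clique of G[H] lies over a clique of G, so over at most
-- a vertices, and over each of them it is a clique of H, so has at most b
-- vertices there.  It arrows (K_{a_1}[H_1],…,K_{a_r}[H_r]): given a colouring,
-- each fibre {u} × V(H) contains a copy of some H_{i(u)} in colour i(u);
-- colouring u by i(u) yields a K_{a_i} in G whose fibres carry copies of H_i in
-- colour i, and these assemble into a copy of K_{a_i}[H_i].  Neither argument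
-- uses anything about the graphs K_{a_i} and H_i, and the bounds a_i ≤ a and
-- cl(H_i) ≤ b only serve to make the right-hand Folkman numbers exist.  Finally
-- the least order of an admissible graph is attained, because admissibility of
-- graphs of a fixed order can be decided by exhaustive search.
module Submission where

open import Defs
open import Data.Nat using (ℕ; zero; suc; _+_; _*_; _≤_; _<_; z≤n; s≤s⁻¹)
open import Data.Nat.Properties
  using (≤-refl; ≤-trans; <⇒≤; ≮⇒≥; ≰⇒>; _≤?_; +-suc; +-mono-≤; n≮n; anyUpTo?; module ≤-Reasoning)
open import Data.Nat.Induction using (<-rec)
open import Data.Bool using (Bool; true; false)
import Data.Bool.Properties as Bool
open import Data.Fin using (Fin; zero; suc; _≟_; remQuot; combine; inject≤)
open import Data.Fin.Properties
  using (any?; all?; remQuot-combine; combine-remQuot; combine-injective; inject≤-injective)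
open import Data.List using (List; []; _∷_; length; map; filter; tabulate; lookup)
open import Data.List.Membership.Propositional.Properties using (∈-lookup)
open import Data.List.Properties using (length-map; length-tabulate)
open import Data.List.Relation.Unary.All as All using (All; []; _∷_)
import Data.List.Relation.Unary.All.Properties as All
open import Data.List.Relation.Unary.AllPairs as AllPairs using (AllPairs; []; _∷_)
import Data.List.Relation.Unary.AllPairs.Properties as AllPairs
open import Data.Vec using (Vec; []; _∷_)
import Data.Vec as Vec
open import Data.Vec.Properties using (lookup∘tabulate)
open import Data.Product using (Σ; ∃; _×_; _,_; proj₁; proj₂; uncurry)
open import Data.Sum using (inj₁; inj₂)
open import Data.Unit using (⊤; tt)
open import Function using (_∘_; id)
open import Function.Definitions using (Injective)
open import Relation.Nullary using (¬_; Dec; yes; no; contradiction)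
open import Relation.Nullary.Decidable using (_×-dec_; _⊎-dec_; _→-dec_; ¬?; map′; decidable-stable)
open import Relation.Unary using (Decidable)
open import Relation.Unary.Properties using (∁?)
open import Relation.Binary.PropositionalEquality
  using (_≡_; _≢_; _≗_; refl; sym; trans; cong; subst; subst₂; module ≡-Reasoning)

LeastWitness≤ : (ℕ → Set) → ℕ → Set
LeastWitness≤ Q n = ∃ λ N → N ≤ n × Q N × (∀ {m} → Q m → N ≤ m)

least-witness : ∀ {Q : ℕ → Set} → Decidable Q → ∀ {n} → Q n → LeastWitness≤ Q n
least-witness {Q} Q? {n} = <-rec (λ n → Q n → LeastWitness≤ Q n) step n
  where
  step : ∀ n → (∀ {m} → m < n → Q m → LeastWitness≤ Q m) → Q n → LeastWitness≤ Q n
  step n below qn with anyUpTo? Q? n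
  ... | yes (m , m<n , qm) =
    let (N , N≤m , qN , least) = below m<n qm in N , ≤-trans N≤m (<⇒≤ m<n) , qN , least
  ... | no ∄below = n , ≤-refl , qn , λ qm → ≮⇒≥ λ m<n → ∄below (_ , m<n , qm)

length-filter-∁ : ∀ {A : Set} {P : A → Set} (P? : Decidable P) xs →
                  length xs ≡ length (filter P? xs) + length (filter (∁? P?) xs)
length-filter-∁ P? [] = refl
length-filter-∁ P? (x ∷ xs) with P? x
... | yes _ = cong suc (length-filter-∁ P? xs)
... | no _ = trans (cong suc (length-filter-∁ P? xs)) (sym (+-suc _ _))

all-filter-⇒ : ∀ {A : Set} {P Q : A → Set} (P? : Decidable P) {xs} →
               All (λ x → P x → Q x) xs → All Q (filter P? xs)
all-filter-⇒ P? {xs} P⇒Q =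
  All.zipWith (λ { (p⇒q , p) → p⇒q p }) (All.filter⁺ P? P⇒Q , All.all-filter P? xs)

allPairs-filter-⇒ : ∀ {A : Set} {P : A → Set} {R : A → A → Set} (P? : Decidable P) {xs} →
                    AllPairs (λ x y → P x → P y → R x y) xs → AllPairs R (filter P? xs)
allPairs-filter-⇒ {P = P} {R} P? {xs} P⇒R = discharge (All.all-filter P? xs) (AllPairs.filter⁺ P? P⇒R)
  where
  discharge : ∀ {ys} → All P ys → AllPairs (λ x y → P x → P y → R x y) ys → AllPairs R ys
  discharge [] [] = []
  discharge (px ∷ ps) (rs ∷ rss) = All.zipWith (λ { (py , r) → r px py }) (ps , rs) ∷ discharge ps rss

Searchable : Set → Set₁
Searchable A = ∀ {P : A → Set} → Decidable P → Dec (∃ P)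

Bool-searchable : Searchable Bool
Bool-searchable P? = map′ (λ { (inj₁ p) → true , p ; (inj₂ p) → false , p })
                          (λ { (true , p) → inj₁ p ; (false , p) → inj₂ p })
                          (P? true ⊎-dec P? false)

Vec-searchable : ∀ {A} → Searchable A → ∀ n → Searchable (Vec A n)
Vec-searchable A-searchable zero P? = map′ ([] ,_) (λ { ([] , p) → p }) (P? [])
Vec-searchable A-searchable (suc n) P? =
  map′ (λ { (x , xs , p) → x ∷ xs , p }) (λ { (x ∷ xs , p) → x , xs , p })
       (A-searchable λ x → Vec-searchable A-searchable n λ xs → P? (x ∷ xs))

Extensional : ∀ {A : Set} {n} → ((Fin n → A) → Set) → Set
Extensional P = ∀ {f g} → f ≗ g → P f → P g

-- Without function extensionality, functions are enumerated through their
-- tabulations, so only predicates respecting ≗ can be searched.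
search-functions : ∀ {A n} {P : (Fin n → A) → Set} → Searchable A → Extensional P → Decidable P →
                   Dec (∃ P)
search-functions {n = n} A-searchable P-ext P? =
  map′ (λ { (v , p) → Vec.lookup v , p })
       (λ { (f , p) → Vec.tabulate f , P-ext (sym ∘ lookup∘tabulate f) p })
       (Vec-searchable A-searchable n (P? ∘ Vec.lookup))

all-functions? : ∀ {A n} {P : (Fin n → A) → Set} → Searchable A → Extensional P → Decidable P →
                 Dec (∀ f → P f)
all-functions? A-searchable P-ext P?
  with search-functions A-searchable (λ f≗g ¬pf → ¬pf ∘ P-ext (sym ∘ f≗g)) (¬? ∘ P?)
... | yes (f , ¬pf) = no λ all → ¬pf (all f)
... | no ∄¬P = yes λ f → decidable-stable (P? f) λ ¬pf → ∄¬P (f , ¬pf)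

-- Copies and cliques

copy-map : ∀ {H G} {X Y : Fin (size G) → Set} → (∀ {x} → X x → Y x) → CopyIn H G X → CopyIn H G Y
copy-map X⇒Y (f , f-inj , f-X , f-hom) = f , f-inj , (λ v → X⇒Y (f-X v)) , f-hom

embed-copy : ∀ {H G G'} {Z : Fin (size G') → Set} (φ : Contains G' G) →
             CopyIn H G (Z ∘ proj₁ φ) → CopyIn H G' Z
embed-copy (φ , φ-inj , _ , φ-hom) (f , f-inj , f-Z , f-hom) =
  φ ∘ f , (λ eq → f-inj (φ-inj eq)) , f-Z , λ u v e → φ-hom _ _ (f-hom u v e)

¬edge-loop : ∀ G {u} → ¬ Edge G u u
¬edge-loop G {u} e = contradiction (trans (sym e) (adj-irrefl G u)) λ ()

Clique : (G : Graph) → List (Fin (size G)) → Set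
Clique G = AllPairs (Edge G)

K-edge⇒≢ : ∀ {k} {i j : Fin k} → Edge (K k) i j → i ≢ j
K-edge⇒≢ {i = i} e refl with i ≟ i
... | yes _ = contradiction e λ ()
... | no i≢i = i≢i refl

≢⇒K-edge : ∀ {k} {i j : Fin k} → i ≢ j → Edge (K k) i j
≢⇒K-edge {i = i} {j} i≢j with i ≟ j
... | yes i≡j = contradiction i≡j i≢j
... | no _ = refl

K-mono : ∀ {m n} → m ≤ n → Contains (K n) (K m)
K-mono m≤n =
  (λ i → inject≤ i m≤n) , (λ eq → inject≤-injective m≤n m≤n _ _ eq) , (λ _ → tt) ,
  λ i j e → ≢⇒K-edge λ eq → K-edge⇒≢ e (inject≤-injective m≤n m≤n i j eq)

clique-lookup : ∀ G {L} → Clique G L → ∀ {i j} → i ≢ j → Edge G (lookup L i) (lookup L j)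
clique-lookup G (_ ∷ _) {zero} {zero} i≢j = contradiction refl i≢j
clique-lookup G (adj₀ ∷ _) {zero} {suc j} _ = All.lookup adj₀ (∈-lookup j)
clique-lookup G {x ∷ _} (adj₀ ∷ _) {suc i} {zero} _ =
  trans (adj-sym G _ x) (All.lookup adj₀ (∈-lookup i))
clique-lookup G (_ ∷ cl) {suc i} {suc j} i≢j = clique-lookup G cl (i≢j ∘ cong suc)

clique⇒copy : ∀ G {L} → Clique G L → Contains G (K (length L))
clique⇒copy G {L} cl =
  lookup L , lookup-injective , (λ _ → tt) , λ i j e → clique-lookup G cl (K-edge⇒≢ e)
  where
  lookup-injective : ∀ {i j} → lookup L i ≡ lookup L j → i ≡ j
  lookup-injective {i} {j} eq with i ≟ j
  ... | yes i≡j = i≡j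
  ... | no i≢j = contradiction (subst (λ y → Edge G y (lookup L j)) eq (clique-lookup G cl i≢j))
                               (¬edge-loop G)

free⇒clique-length≤ : ∀ G {c L} → Free (suc c) G → Clique G L → length L ≤ c
free⇒clique-length≤ G {c} {L} G-free cl with length L ≤? c
... | yes ≤c = ≤c
... | no ≰c =
  contradiction (embed-copy {K (suc c)} {K (length L)} {G} (clique⇒copy G cl) (K-mono (≰⇒> ≰c))) G-free

-- Lexicographic products

lexAdjP-fibre : ∀ G H u {v v'} → lexAdjP G H (u , v) (u , v') ≡ adj H v v'
lexAdjP-fibre G H u rewrite adj-irrefl G u with u ≟ u
... | yes _ = refl
... | no u≢u = contradiction refl u≢u

lexAdjP-apart : ∀ G H {u u' v v'} → u ≢ u' → lexAdjP G H (u , v) (u' , v') ≡ adj G u u'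
lexAdjP-apart G H {u} {u'} u≢u' with u ≟ u'
... | yes u≡u' = contradiction u≡u' u≢u'
... | no _ = Bool.∨-identityʳ _

lexAdjP-outer : ∀ G H {u u' v v'} → Edge G u u' → lexAdjP G H (u , v) (u' , v') ≡ true
lexAdjP-outer G H e rewrite e = refl

lex-copy : ∀ {G H G' H' : Graph} {X : Fin (size G') → Set} {Y : Fin (size G' * size H') → Set} →
           (φ : CopyIn G G' X) → (∀ j → CopyIn H H' (λ v → Y (combine (proj₁ φ j) v))) →
           CopyIn (Lex G H) (Lex G' H') Y
lex-copy {G} {H} {G'} {H'} {Y = Y} (g , g-inj , _ , g-hom) ψ =
  χ ∘ remQuot (size H) , χ∘remQuot-injective , (λ y → h-colour (proj₁ (remQuot (size H) y)) _) ,
  λ y y' → χ-hom (remQuot (size H) y) (remQuot (size H) y')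
  where
  h : ∀ j → Fin (size H) → Fin (size H')
  h j = proj₁ (ψ j)

  h-injective : ∀ j → Injective _≡_ _≡_ (h j)
  h-injective j = proj₁ (proj₂ (ψ j))

  h-colour : ∀ j w → Y (combine (g j) (h j w))
  h-colour j = proj₁ (proj₂ (proj₂ (ψ j)))

  h-hom : ∀ j w w' → Edge H w w' → Edge H' (h j w) (h j w')
  h-hom j = proj₂ (proj₂ (proj₂ (ψ j)))

  χ : Fin (size G) × Fin (size H) → Fin (size G' * size H')
  χ (j , w) = combine (g j) (h j w)

  χ-injective : ∀ p q → χ p ≡ χ q → p ≡ q
  χ-injective (j , w) (j' , w') eq with combine-injective (g j) (h j w) (g j') (h j' w') eq
  ... | gj≡gj' , hw≡hw' with g-inj gj≡gj'
  ... | refl = cong (j ,_) (h-injective j hw≡hw')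

  χ∘remQuot-injective : ∀ {y y'} → χ (remQuot (size H) y) ≡ χ (remQuot (size H) y') → y ≡ y'
  χ∘remQuot-injective {y} {y'} eq = begin
    y                                            ≡⟨ combine-remQuot {size G} (size H) y ⟨
    uncurry combine (remQuot {size G} _ y)       ≡⟨ cong (uncurry combine) (χ-injective _ _ eq) ⟩
    uncurry combine (remQuot {size G} _ y')      ≡⟨ combine-remQuot {size G} (size H) y' ⟩
    y'                                           ∎
    where open ≡-Reasoning

  χ-hom : ∀ p q → lexAdjP G H p q ≡ true →
          lexAdjP G' H' (remQuot (size H') (χ p)) (remQuot (size H') (χ q)) ≡ true
  χ-hom p@(j , w) q@(j' , w') e =
    subst₂ (λ x y → lexAdjP G' H' x y ≡ true)
           (sym (remQuot-combine (g j) (h j w))) (sym (remQuot-combine (g j') (h j' w')))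
           (pair-hom (j ≟ j'))
    where
    pair-hom : Dec (j ≡ j') → lexAdjP G' H' (g j , h j w) (g j' , h j' w') ≡ true
    pair-hom (yes refl) = trans (lexAdjP-fibre G' H' (g j)) (h-hom j w w' (trans (sym (lexAdjP-fibre G H j)) e))
    pair-hom (no j≢j') = lexAdjP-outer G' H' (g-hom j j' (trans (sym (lexAdjP-apart G H j≢j')) e))

arrows-lex : ∀ G H {r} {Gs Hs : Fin r → Graph} → Arrows G r Gs → Arrows H r Hs →
             Arrows (Lex G H) r (λ i → Lex (Gs i) (Hs i))
arrows-lex G H {r} {Gs} {Hs} G-arrows H-arrows c = combineFibres (G-arrows (proj₁ ∘ fibre))
  where
  fibre : ∀ u → ∃ λ i → CopyIn (Hs i) H (λ v → c (combine u v) ≡ i)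
  fibre u = H-arrows (λ v → c (combine u v))

  combineFibres : (∃ λ i → CopyIn (Gs i) G (λ u → proj₁ (fibre u) ≡ i)) →
                  ∃ λ i → CopyIn (Lex (Gs i) (Hs i)) (Lex G H) (λ z → c z ≡ i)
  combineFibres (i , φ@(g , _ , fibre-colour , _)) =
    i , lex-copy {Gs i} {Hs i} {G} {H} {λ u → proj₁ (fibre u) ≡ i} {λ z → c z ≡ i} φ ψ
    where
    ψ : ∀ j → CopyIn (Hs i) H (λ v → c (combine (g j) v) ≡ i)
    ψ j = subst (λ t → CopyIn (Hs t) H (λ v → c (combine (g j) v) ≡ t))
                (fibre-colour j) (proj₂ (fibre (g j)))

LexClique : (G H : Graph) → List (Fin (size G) × Fin (size H)) → Set
LexClique G H = AllPairs (λ p q → lexAdjP G H p q ≡ true)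

-- W confines the clique to the fibres over a part of G without cliques of size
-- c + 1.  The vertices outside the fibre of the first vertex u lie over the
-- neighbourhood of u, where that bound drops to c.
lexClique-length≤ : ∀ G H {b} → (∀ {L} → Clique H L → length L ≤ b) →
                    ∀ c (W : Fin (size G) → Set) → (∀ {U} → Clique G U → All W U → length U ≤ c) →
                    ∀ {L} → LexClique G H L → All (W ∘ proj₁) L → length L ≤ c * b
lexClique-length≤ G H H-bound c W G-bound [] [] = z≤n
lexClique-length≤ G H H-bound zero W G-bound (_ ∷ _) (w ∷ _) with G-bound ([] ∷ []) (w ∷ [])
... | ()
lexClique-length≤ G H {b} H-bound (suc c) W G-bound {(u , v) ∷ L} (adjs ∷ cl) (w ∷ ws) = begin
  suc (length L)                               ≡⟨ cong suc (length-filter-∁ inFibre? L) ⟩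
  suc (length fibre) + length rest             ≡⟨ cong (λ n → suc n + length rest) (length-map proj₂ fibre) ⟨
  length (v ∷ map proj₂ fibre) + length rest   ≤⟨ +-mono-≤ (H-bound fibre-clique) rest-bound ⟩
  b + c * b                                    ∎
  where
  open ≤-Reasoning

  InFibre : Fin (size G) × Fin (size H) → Set
  InFibre p = proj₁ p ≡ u

  inFibre? : Decidable InFibre
  inFibre? p = proj₁ p ≟ u

  fibre rest : List (Fin (size G) × Fin (size H))
  fibre = filter inFibre? L
  rest = filter (∁? inFibre?) L

  fibre-edge : ∀ {p q} → lexAdjP G H p q ≡ true → InFibre p → InFibre q →
               Edge H (proj₂ p) (proj₂ q)
  fibre-edge {_ , _} {_ , _} e refl refl = trans (sym (lexAdjP-fibre G H u)) e

  fibre-clique : Clique H (v ∷ map proj₂ fibre)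
  fibre-clique = All.map⁺ (all-filter-⇒ inFibre? (All.map (λ e → fibre-edge e refl) adjs))
               ∷ AllPairs.map⁺ (allPairs-filter-⇒ inFibre? (AllPairs.map fibre-edge cl))

  InNeighbourhood : Fin (size G) → Set
  InNeighbourhood u' = W u' × Edge G u u'

  rest-in-neighbourhood : ∀ {p} → W (proj₁ p) × lexAdjP G H (u , v) p ≡ true → ¬ InFibre p →
                          InNeighbourhood (proj₁ p)
  rest-in-neighbourhood {_ , _} (w' , e) u'≢u = w' , trans (sym (lexAdjP-apart G H (u'≢u ∘ sym))) e

  neighbourhood-bound : ∀ {U} → Clique G U → All InNeighbourhood U → length U ≤ c
  neighbourhood-bound cl' ws' = s≤s⁻¹ (G-bound (All.map proj₂ ws' ∷ cl') (w ∷ All.map proj₁ ws'))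

  rest-bound : length rest ≤ c * b
  rest-bound = lexClique-length≤ G H H-bound c InNeighbourhood neighbourhood-bound
                 (AllPairs.filter⁺ (∁? inFibre?) cl)
                 (all-filter-⇒ (∁? inFibre?) (All.zipWith rest-in-neighbourhood (ws , adjs)))

free-lex : ∀ G H {a b} → Free (suc a) G → Free (suc b) H → Free (suc (a * b)) (Lex G H)
free-lex G H {a} {b} G-free H-free (f , _ , _ , f-hom) =
  n≮n (a * b) (subst (_≤ a * b) (length-tabulate pairs) pairs-bound)
  where
  pairs : Fin (suc (a * b)) → Fin (size G) × Fin (size H)
  pairs = remQuot (size H) ∘ f

  pairs-bound : length (tabulate pairs) ≤ a * b
  pairs-bound = lexClique-length≤ G H (free⇒clique-length≤ H H-free) a (λ _ → ⊤)
                  (λ cl _ → free⇒clique-length≤ G G-free cl)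
                  (AllPairs.tabulate⁺ λ i≢j → f-hom _ _ (≢⇒K-edge i≢j))
                  (All.universal (λ _ → tt) _)

admissible-lex : ∀ {r} (Gs Hs : Fin r → Graph) a b G H →
                 Admissible r Gs (suc a) G → Admissible r Hs (suc b) H →
                 Admissible r (λ i → Lex (Gs i) (Hs i)) (suc (a * b)) (Lex G H)
admissible-lex Gs Hs a b G H (G-free , G-arrows) (H-free , H-arrows) =
  free-lex G H {a} {b} G-free H-free , arrows-lex G H {Gs = Gs} {Hs} G-arrows H-arrows

-- Deciding admissibility

admissible-respects : ∀ {r k} {Hs : Fin r → Graph} {G G'} → Contains G G' → Contains G' G →
                      Admissible r Hs k G → Admissible r Hs k G'
admissible-respects {k = k} {Hs = Hs} {G = G} {G'} G'⊆G G⊆G' (G-free , G-arrows) =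
  (λ K⊆G' → G-free (embed-copy {H = K k} {G'} {G} G'⊆G K⊆G')) ,
  λ c → let (i , copy) = G-arrows (c ∘ proj₁ G⊆G')
        in i , embed-copy {H = Hs i} {G} {G'} {Z = λ y → c y ≡ i} G⊆G' copy

IsCopy : (H G : Graph) → (Fin (size G) → Set) → (Fin (size H) → Fin (size G)) → Set
IsCopy H G X f = Injective _≡_ _≡_ f × (∀ v → X (f v)) × (∀ u v → Edge H u v → Edge G (f u) (f v))

isCopy-extensional : ∀ H G {X} → Extensional (IsCopy H G X)
isCopy-extensional H G {X} {f} {g} f≗g (f-inj , f-X , f-hom) =
  (λ eq → f-inj (trans (f≗g _) (trans eq (sym (f≗g _))))) ,
  (λ v → subst X (f≗g v) (f-X v)) ,
  (λ u v e → subst₂ (Edge G) (f≗g u) (f≗g v) (f-hom u v e))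

isCopy? : ∀ H G {X} → Decidable X → Decidable (IsCopy H G X)
isCopy? H G X? f =
  injective? ×-dec all? (X? ∘ f) ×-dec all? λ u → all? λ v → edge? H u v →-dec edge? G (f u) (f v)
  where
  edge? : ∀ G u v → Dec (Edge G u v)
  edge? G u v = adj G u v Bool.≟ true

  injective? : Dec (Injective _≡_ _≡_ f)
  injective? = map′ (λ inj {x} {y} → inj x y) (λ inj x y → inj)
                    (all? λ x → all? λ y → (f x ≟ f y) →-dec (x ≟ y))

copyIn? : ∀ H G {X} → Decidable X → Dec (CopyIn H G X)
copyIn? H G {X} X? = search-functions any? (isCopy-extensional H G {X}) (isCopy? H G X?)

admissible? : ∀ r Hs k G → Dec (Admissible r Hs k G)
admissible? r Hs k G =
  ¬? (copyIn? (K k) G λ _ → yes tt) ×-dec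
  all-functions? any? monochromatic-extensional (λ c → any? λ i → copyIn? (Hs i) G λ x → c x ≟ i)
  where
  monochromatic-extensional : Extensional (λ c → ∃ λ i → CopyIn (Hs i) G (λ x → c x ≡ i))
  monochromatic-extensional c≗c' (i , copy) =
    i , copy-map {Hs i} {G} (λ {x} cx≡i → trans (sym (c≗c' x)) cx≡i) copy

graphOn : (N : ℕ) (ad : Fin N → Fin N → Bool) →
          (∀ u v → ad u v ≡ ad v u) → (∀ u → ad u u ≡ false) → Graph
graphOn N ad ad-sym ad-irrefl = record { size = N ; adj = ad ; adj-sym = ad-sym ; adj-irrefl = ad-irrefl }

admissible-pointwise : ∀ {r Hs k} G {ad} ad-sym ad-irrefl → (∀ u v → adj G u v ≡ ad u v) →
                       Admissible r Hs k G → Admissible r Hs k (graphOn (size G) ad ad-sym ad-irrefl)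
admissible-pointwise {r} {Hs} {k} G {ad} ad-sym ad-irrefl adj≗ad =
  admissible-respects {r} {k} {Hs} {G} {G'}
    (id , id , _ , λ u v e → trans (adj≗ad u v) e) (id , id , _ , λ u v e → trans (sym (adj≗ad u v)) e)
  where
  G' : Graph
  G' = graphOn (size G) ad ad-sym ad-irrefl

AdmissibleOfOrder : (r : ℕ) → (Fin r → Graph) → ℕ → ℕ → Set
AdmissibleOfOrder r Hs k N = Σ Graph λ G → size G ≡ N × Admissible r Hs k G

matrixAdj : ∀ {N} → Vec (Vec Bool N) N → Fin N → Fin N → Bool
matrixAdj M u v = Vec.lookup (Vec.lookup M u) v

adjacencyMatrix : (G : Graph) → Vec (Vec Bool (size G)) (size G)
adjacencyMatrix G = Vec.tabulate (Vec.tabulate ∘ adj G)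

adj≗matrixAdj : ∀ G u v → adj G u v ≡ matrixAdj (adjacencyMatrix G) u v
adj≗matrixAdj G u v = sym (begin
  Vec.lookup (Vec.lookup (adjacencyMatrix G) u) v  ≡⟨ cong (λ row → Vec.lookup row v) (lookup∘tabulate _ u) ⟩
  Vec.lookup (Vec.tabulate (adj G u)) v            ≡⟨ lookup∘tabulate _ v ⟩
  adj G u v                                        ∎)
  where open ≡-Reasoning

admissibleOfOrder? : ∀ r Hs k N → Dec (AdmissibleOfOrder r Hs k N)
admissibleOfOrder? r Hs k N =
  map′ fromMatrix toMatrix (Vec-searchable (Vec-searchable Bool-searchable N) N admissibleMatrix?)
  where
  AdmissibleMatrix : Vec (Vec Bool N) N → Set
  AdmissibleMatrix M = Σ (∀ u v → matrixAdj M u v ≡ matrixAdj M v u) λ M-sym →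
                       Σ (∀ u → matrixAdj M u u ≡ false) λ M-irrefl →
                       Admissible r Hs k (graphOn N (matrixAdj M) M-sym M-irrefl)

  admissibleMatrix? : Decidable AdmissibleMatrix
  admissibleMatrix? M with all? (λ u → all? λ v → matrixAdj M u v Bool.≟ matrixAdj M v u)
                         | all? (λ u → matrixAdj M u u Bool.≟ false)
  ... | no ¬sym | _ = no (¬sym ∘ proj₁)
  ... | yes _ | no ¬irrefl = no (¬irrefl ∘ proj₁ ∘ proj₂)
  ... | yes M-sym | yes M-irrefl =
    map′ (λ A → M-sym , M-irrefl , A)
         (λ { (M-sym' , M-irrefl' , A) →
              admissible-pointwise {r} {Hs} {k} (graphOn N (matrixAdj M) M-sym' M-irrefl')
                                   M-sym M-irrefl (λ _ _ → refl) A })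
         (admissible? r Hs k (graphOn N (matrixAdj M) M-sym M-irrefl))

  fromMatrix : ∃ AdmissibleMatrix → AdmissibleOfOrder r Hs k N
  fromMatrix (M , M-sym , M-irrefl , A) = graphOn N (matrixAdj M) M-sym M-irrefl , refl , A

  toMatrix : AdmissibleOfOrder r Hs k N → ∃ AdmissibleMatrix
  toMatrix (G , refl , A) =
    adjacencyMatrix G , M-sym , M-irrefl ,
    admissible-pointwise {r} {Hs} {k} G M-sym M-irrefl (adj≗matrixAdj G) A
    where
    M-sym : ∀ u v → matrixAdj (adjacencyMatrix G) u v ≡ matrixAdj (adjacencyMatrix G) v u
    M-sym u v = trans (sym (adj≗matrixAdj G u v)) (trans (adj-sym G u v) (adj≗matrixAdj G v u))

    M-irrefl : ∀ u → matrixAdj (adjacencyMatrix G) u u ≡ false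
    M-irrefl u = trans (sym (adj≗matrixAdj G u u)) (adj-irrefl G u)

folkmanNumber-exists : ∀ {r} (Hs : Fin r → Graph) k G → Admissible r Hs k G →
                       ∃ λ N → IsFolkmanNumber r Hs k N × N ≤ size G
folkmanNumber-exists {r} Hs k G A with least-witness (admissibleOfOrder? r Hs k) (G , refl , A)
... | N , N≤ , witness , least = N , (witness , λ G' A' → least (G' , refl , A')) , N≤

theorem3 : (r : ℕ) → 1 ≤ r → (a b : ℕ) → 1 ≤ a → 1 ≤ b →
    (as : Fin r → ℕ) → (∀ i → 1 ≤ as i) → (Hs : Fin r → Graph) →
    (∀ i → as i ≤ a) → (∀ i → CliqueNumber≤ (Hs i) b) →
    (n m : ℕ) →
    IsFolkmanNumber r (λ i → K (as i)) (suc a) n →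
    IsFolkmanNumber r Hs (suc b) m →
    ∃ λ N → IsFolkmanNumber r (λ i → Lex (K (as i)) (Hs i)) (suc (a * b)) N × N ≤ n * m
theorem3 r _ a b _ _ as _ Hs _ _ _ _ ((G , refl , G-admissible) , _) ((H , refl , H-admissible) , _) =
  folkmanNumber-exists (λ i → Lex (Ks i) (Hs i)) (suc (a * b)) (Lex G H)
                       (admissible-lex Ks Hs a b G H G-admissible H-admissible)
  where
  Ks : Fin r → Graph
  Ks i = K (as i)
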